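{- Let $\mathcal{A}$ be a d-class of subsets of a set $\Omega$ and let $A_1,\dots,A_n\in\mathcal{A}$. Then there exist pairwise disjoint sets $B_1,\dots,B_m\in\mathcal{A}$, each of which is a union of some of the $A_i$, such that $\bigcup_{i=1}^nA_i=\bigsqcup_{j=1}^mB_j$.
   Context: A collection $\mathcal{A}$ of subsets of a set $\Omega$ is a d-class if it contains the empty set and, whenever $A,B\in\mathcal{A}$ have non-empty intersection, both $A\cap B$ and $A\cup B$ belong to $\mathcal{A}$. -}

module Defs where

open import Level using (Level; _⊔_; suc)
open import Data.Nat using (ℕ)
open import Data.Fin using (Fin)
open import Data.Fin.Subset using (Subset) renaming (_∈_ to _∈ₛ_)
open import Data.Product using (Σ; ∃; _×_)
open import Relation.Binary.PropositionalEquality using (_≡_)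
open import Relation.Nullary using (¬_)
open import Relation.Unary using (Pred; _∈_; _∩_; _∪_; _≬_; _⊥_; _≐_; Empty; ⋃)

private variable a ℓ c : Level

record IsDClass {Ω : Set a} (𝒜 : Pred (Pred Ω ℓ) c) : Set (a ⊔ suc ℓ ⊔ c) where
  field
    has-∅   : Σ (Pred Ω ℓ) (λ E → E ∈ 𝒜 × Empty E)
    ∩-closed : ∀ {A B} → A ∈ 𝒜 → B ∈ 𝒜 → A ≬ B → (A ∩ B) ∈ 𝒜
    ∪-closed : ∀ {A B} → A ∈ 𝒜 → B ∈ 𝒜 → A ≬ B → (A ∪ B) ∈ 𝒜

⋃ₛ : {Ω : Set a} {n : ℕ} → Subset n → (Fin n → Pred Ω ℓ) → Pred Ω ℓ
⋃ₛ {n = n} S A = λ x → Σ (Fin n) (λ i → i ∈ₛ S × x ∈ A i)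

PairwiseDisjoint : {Ω : Set a} {m : ℕ} → (Fin m → Pred Ω ℓ) → Set (a ⊔ ℓ)
PairwiseDisjoint {m = m} B = ∀ (j k : Fin m) → ¬ (j ≡ k) → B j ⊥ B k

{-# OPTIONS --safe #-}
-- Insert the sets one at a time into a pairwise disjoint family. A new set C
-- absorbs, one after another, every block it meets; a union of two overlapping
-- members of the d-class is again a member, and a block that C does not meet
-- stays disjoint from everything else.
module Submission where

open import Defs
open import Level using (Level; _⊔_) renaming (suc to lsuc)
open import Data.Nat using (ℕ; zero; suc)
open import Data.Fin using (Fin; zero; suc)
open import Data.Fin.Properties using (suc-injective)
open import Data.Fin.Subset using (Subset; ⁅_⁆) renaming (_∪_ to _∪ₛ_)
open import Data.Fin.Subset.Properties using (x∈⁅x⁆; x∈⁅y⁆⇒x≡y; x∈p∪q⁻; x∈p∪q⁺)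
open import Data.Vec.Functional using (_∷_; head; tail)
open import Data.Product using (Σ; _×_; _,_; proj₁; proj₂)
open import Data.Sum using (inj₁; inj₂; [_,_])
open import Data.Empty using (⊥-elim)
open import Function using (_∘_)
open import Relation.Nullary using (yes; no)
open import Relation.Binary.PropositionalEquality using (refl; subst)
open import Relation.Unary using (Pred; _∈_; _⊆_; _≐_; ⋃; _∪_; _∩_; _≬_; _⊥_; Empty)
open import Relation.Unary.Properties using (≐-refl; ≐-sym; ≐-trans; ≬-sym)
open import Relation.Unary.Algebra using (∪-cong; ∪-comm; ∪-assoc)
open import Relation.Unary.Relation.Binary.Equality using (≐-setoid)
import Relation.Binary.Reasoning.Setoid as SetoidReasoning
open import Axiom.ExcludedMiddle using (ExcludedMiddle)

private variable a c : Level

module _ {Ω : Set a} {ℓ : Level} where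

  open SetoidReasoning (≐-setoid Ω ℓ)

  private variable
    m : ℕ
    X Y D E : Pred Ω ℓ

  ⋃-suc : (B : Fin (suc m) → Pred Ω ℓ) → ⋃ (Fin (suc m)) B ≐ head B ∪ ⋃ (Fin m) (tail B)
  ⋃-suc B = (λ { (zero , x) → inj₁ x ; (suc j , x) → inj₂ (j , x) })
          , [ zero ,_ , (λ (j , x) → suc j , x) ]

  ∪-⋃-suc : (B : Fin (suc m) → Pred Ω ℓ) →
            X ∪ ⋃ (Fin (suc m)) B ≐ (X ∪ head B) ∪ ⋃ (Fin m) (tail B)
  ∪-⋃-suc {X = X} B = begin
    X ∪ ⋃ _ B                          ≈⟨ ∪-cong (≐-refl {x = X}) (⋃-suc B) ⟩
    X ∪ (head B ∪ ⋃ _ (tail B))        ≈⟨ ∪-assoc X (head B) _ ⟨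
    (X ∪ head B) ∪ ⋃ _ (tail B)        ∎

  ⊥-∪ : X ⊥ Y → X ⊥ D → X ⊥ (Y ∪ D)
  ⊥-∪ X⊥Y X⊥D (x∈X , inj₁ x∈Y) = X⊥Y (x∈X , x∈Y)
  ⊥-∪ X⊥Y X⊥D (x∈X , inj₂ x∈D) = X⊥D (x∈X , x∈D)

  ⊥-antimonoʳ : E ⊆ D → X ⊥ D → X ⊥ E
  ⊥-antimonoʳ E⊆D X⊥D (x∈X , x∈E) = X⊥D (x∈X , E⊆D x∈E)

  head-⊥-⋃-tail : (B : Fin (suc m) → Pred Ω ℓ) → PairwiseDisjoint B → head B ⊥ ⋃ (Fin m) (tail B)
  head-⊥-⋃-tail B disj (x∈B₀ , (j , x∈Bⱼ)) = disj zero (suc j) (λ ()) (x∈B₀ , x∈Bⱼ)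

  pairwiseDisjoint-tail : (B : Fin (suc m) → Pred Ω ℓ) → PairwiseDisjoint B → PairwiseDisjoint (tail B)
  pairwiseDisjoint-tail B disj j k j≢k = disj (suc j) (suc k) (j≢k ∘ suc-injective)

  pairwiseDisjoint-∷ : {B : Fin m → Pred Ω ℓ} → X ⊥ ⋃ (Fin m) B → PairwiseDisjoint B →
                       PairwiseDisjoint (X ∷ B)
  pairwiseDisjoint-∷ X⊥B disj zero    zero    j≢k = ⊥-elim (j≢k refl)
  pairwiseDisjoint-∷ X⊥B disj zero    (suc k) _   (x∈X , x∈Bₖ) = X⊥B (x∈X , (k , x∈Bₖ))
  pairwiseDisjoint-∷ X⊥B disj (suc j) zero    _   (x∈Bⱼ , x∈X) = X⊥B (x∈X , (j , x∈Bⱼ))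
  pairwiseDisjoint-∷ X⊥B disj (suc j) (suc k) j≢k = disj j k (λ { refl → j≢k refl })

  record DisjointDecomposition (𝒫 : Pred (Pred Ω ℓ) c) (D : Pred Ω ℓ) : Set (a ⊔ lsuc ℓ ⊔ c) where
    field
      size     : ℕ
      block    : Fin size → Pred Ω ℓ
      block∈𝒫  : ∀ j → block j ∈ 𝒫
      disjoint : PairwiseDisjoint block
      cover    : D ≐ ⋃ (Fin size) block

  module _ {𝒫 : Pred (Pred Ω ℓ) c} where

    decomposition-resp-≐ : D ≐ E → DisjointDecomposition 𝒫 D → DisjointDecomposition 𝒫 E
    decomposition-resp-≐ D≐E 𝒟 = record
      { size = size ; block = block ; block∈𝒫 = block∈𝒫 ; disjoint = disjoint
      ; cover = ≐-trans (≐-sym D≐E) cover }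
      where open DisjointDecomposition 𝒟

    empty-decomposition : Empty D → DisjointDecomposition 𝒫 D
    empty-decomposition ∅D = record
      { size = 0 ; block = λ () ; block∈𝒫 = λ () ; disjoint = λ ()
      ; cover = (λ x∈D → ⊥-elim (∅D _ x∈D)) , λ () }

    ∷-decomposition : X ∈ 𝒫 → X ⊥ D → DisjointDecomposition 𝒫 D → DisjointDecomposition 𝒫 (X ∪ D)
    ∷-decomposition {X = X} {D = D} X∈𝒫 X⊥D 𝒟 = record
      { size     = suc size
      ; block    = X ∷ block
      ; block∈𝒫  = λ { zero → X∈𝒫 ; (suc j) → block∈𝒫 j }
      ; disjoint = pairwiseDisjoint-∷ {X = X} {B = block}
                     (⊥-antimonoʳ {E = ⋃ (Fin size) block} (proj₂ cover) X⊥D) disjoint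
      ; cover    = begin
          X ∪ D                      ≈⟨ ∪-cong (≐-refl {x = X}) cover ⟩
          X ∪ ⋃ (Fin size) block     ≈⟨ ⋃-suc (X ∷ block) ⟨
          ⋃ (Fin (suc size)) (X ∷ block) ∎
      }
      where open DisjointDecomposition 𝒟

  OverlapUnionClosed : Pred (Pred Ω ℓ) c → Set (a ⊔ lsuc ℓ ⊔ c)
  OverlapUnionClosed 𝒫 = ∀ {X Y} → X ∈ 𝒫 → Y ∈ 𝒫 → X ≬ Y → X ∪ Y ∈ 𝒫

  module _ (em : ExcludedMiddle (a ⊔ ℓ)) {𝒫 : Pred (Pred Ω ℓ) c} (∪-closed : OverlapUnionClosed 𝒫) where

    insert : (B : Fin m → Pred Ω ℓ) → (∀ j → B j ∈ 𝒫) → PairwiseDisjoint B →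
             X ∈ 𝒫 → DisjointDecomposition 𝒫 (X ∪ ⋃ (Fin m) B)
    insert {m = zero} B _ _ X∈𝒫 =
      ∷-decomposition {D = ⋃ (Fin 0) B} X∈𝒫 (λ { (_ , () , _) })
        (empty-decomposition λ _ → λ { (() , _) })
    insert {m = suc m} {X = X} B B∈𝒫 disj X∈𝒫 with em {head B ≬ X}
    ... | yes B₀≬X = decomposition-resp-≐ (≐-sym (∪-⋃-suc B))
      (insert (tail B) (B∈𝒫 ∘ suc) (pairwiseDisjoint-tail B disj) (∪-closed X∈𝒫 (B∈𝒫 zero) (≬-sym B₀≬X)))
    ... | no ¬B₀≬X = decomposition-resp-≐ keep-head
      (∷-decomposition (B∈𝒫 zero) (⊥-∪ {Y = X} {D = ⋃ (Fin m) (tail B)} B₀⊥X (head-⊥-⋃-tail B disj))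
        (insert (tail B) (B∈𝒫 ∘ suc) (pairwiseDisjoint-tail B disj) X∈𝒫))
      where
      B₀⊥X : head B ⊥ X
      B₀⊥X B₀∩X = ¬B₀≬X (_ , B₀∩X)

      keep-head : head B ∪ (X ∪ ⋃ (Fin m) (tail B)) ≐ X ∪ ⋃ (Fin (suc m)) B
      keep-head = begin
        head B ∪ (X ∪ ⋃ _ (tail B))    ≈⟨ ∪-assoc (head B) X _ ⟨
        (head B ∪ X) ∪ ⋃ _ (tail B)    ≈⟨ ∪-cong (∪-comm (head B) X) (≐-refl {x = ⋃ _ (tail B)}) ⟩
        (X ∪ head B) ∪ ⋃ _ (tail B)    ≈⟨ ∪-⋃-suc B ⟨
        X ∪ ⋃ _ B                      ∎

    decompose : (A : Fin m → Pred Ω ℓ) → (∀ i → A i ∈ 𝒫) → DisjointDecomposition 𝒫 (⋃ (Fin m) A)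
    decompose {m = zero}  A _ = empty-decomposition λ _ → λ { (() , _) }
    decompose {m = suc m} A A∈𝒫 = decomposition-resp-≐ cover′ (insert block block∈𝒫 disjoint (A∈𝒫 zero))
      where
      open DisjointDecomposition (decompose (tail A) (A∈𝒫 ∘ suc))
      cover′ : head A ∪ ⋃ (Fin size) block ≐ ⋃ (Fin (suc m)) A
      cover′ = begin
        head A ∪ ⋃ _ block      ≈⟨ ∪-cong (≐-refl {x = head A}) cover ⟨
        head A ∪ ⋃ _ (tail A)   ≈⟨ ⋃-suc A ⟨
        ⋃ _ A                   ∎

  module _ {n : ℕ} (A : Fin n → Pred Ω ℓ) where

    UnionOfSome : Pred (Pred Ω ℓ) (a ⊔ ℓ)
    UnionOfSome X = Σ (Subset n) λ S → X ≐ ⋃ₛ S A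

    ⋃ₛ-∪ : ∀ S T → ⋃ₛ (S ∪ₛ T) A ≐ ⋃ₛ S A ∪ ⋃ₛ T A
    ⋃ₛ-∪ S T =
      (λ (i , i∈S∪T , x∈Aᵢ) →
         [ (λ i∈S → inj₁ (i , i∈S , x∈Aᵢ)) , (λ i∈T → inj₂ (i , i∈T , x∈Aᵢ)) ] (x∈p∪q⁻ S T i∈S∪T))
      , [ (λ (i , i∈S , x∈Aᵢ) → i , x∈p∪q⁺ (inj₁ i∈S) , x∈Aᵢ)
        , (λ (i , i∈T , x∈Aᵢ) → i , x∈p∪q⁺ (inj₂ i∈T) , x∈Aᵢ) ]

    ⋃ₛ-⁅⁆ : ∀ i → ⋃ₛ ⁅ i ⁆ A ≐ A i
    ⋃ₛ-⁅⁆ i = (λ (j , j∈⁅i⁆ , x∈Aⱼ) → subst (λ k → _ ∈ A k) (x∈⁅y⁆⇒x≡y i j∈⁅i⁆) x∈Aⱼ)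
            , (λ x∈Aᵢ → i , x∈⁅x⁆ i , x∈Aᵢ)

    unionOfSome-∪ : X ∈ UnionOfSome → Y ∈ UnionOfSome → X ∪ Y ∈ UnionOfSome
    unionOfSome-∪ (S , X≐) (T , Y≐) = S ∪ₛ T , ≐-trans (∪-cong X≐ Y≐) (≐-sym (⋃ₛ-∪ S T))

    member-unionOfSome : ∀ i → A i ∈ UnionOfSome
    member-unionOfSome i = ⁅ i ⁆ , ≐-sym (⋃ₛ-⁅⁆ i)

mainTheorem17 : ∀ {a ℓ c} → ExcludedMiddle (a ⊔ ℓ) →
    {Ω : Set a} (𝒜 : Pred (Pred Ω ℓ) c) → IsDClass 𝒜 →
    (n : ℕ) (A : Fin n → Pred Ω ℓ) → (∀ i → A i ∈ 𝒜) →
    Σ ℕ λ m → Σ (Fin m → Pred Ω ℓ) λ B →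
    (∀ j → B j ∈ 𝒜) ×
    (∀ j → Σ (Subset n) λ S → B j ≐ ⋃ₛ S A) ×
    PairwiseDisjoint B ×
    (⋃ (Fin n) A ≐ ⋃ (Fin m) B)
mainTheorem17 em 𝒜 d-class n A A∈𝒜 =
  size , block , proj₁ ∘ block∈𝒫 , proj₂ ∘ block∈𝒫 , disjoint , cover
  where
  open IsDClass d-class using (∪-closed)

  ∪-closed′ : OverlapUnionClosed (𝒜 ∩ UnionOfSome A)
  ∪-closed′ (X∈𝒜 , X∈⋃) (Y∈𝒜 , Y∈⋃) X≬Y = ∪-closed X∈𝒜 Y∈𝒜 X≬Y , unionOfSome-∪ A X∈⋃ Y∈⋃

  open DisjointDecomposition (decompose em ∪-closed′ A λ i → A∈𝒜 i , member-unionOfSome A i)
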